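{- Let $(y_n)_{n\ge1}$ be a nondecreasing sequence of positive integers with output sequence $W(n)$, and set $y_0=0$. Then for every $n\ge1$, $$\prod_{k=0}^{n-1}(1+y_{k+1}-y_k)\le W(n)\le\prod_{k=1}^{n}(1+y_k).$$
   Context: For a nondecreasing sequence $(y_n)_{n\ge1}$ of positive integers and a positive integer $n$, an $n$-tuple $(x_1,\dots,x_n)$ of nonnegative integers is valid if $x_1\le y_n$ and $x_{j+1}\le\min(x_j,y_{n-j})$ for $1\le j\le n-1$. The output sequence $W(n)$ is the number of valid $n$-tuples, i.e. $W(n)=\sum_{k\ge0}A(n,k)$ where $A(n,k)$ is the number of valid $n$-tuples with $x_1=k$. -}

module Defs where

open import Data.Nat using (ℕ; zero; suc; _+_; _*_; _∸_; _≤_; _≤?_)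
open import Data.List using (List; []; _∷_; map; concatMap; filter; length; upTo)
open import Data.Vec using (Vec; []; _∷_)
open import Data.Product using (_×_; _,_)
open import Data.Unit using (⊤)
open import Relation.Nullary using (Dec; yes; no)
open import Relation.Nullary.Decidable using (_×-dec_)

-- A sequence (y_n)_{n≥1} is modelled as y : ℕ → ℕ, where only the values
-- y 1, y 2, ... are constrained; the value y 0 is irrelevant (the paper's
-- convention y_0 = 0 is implemented by y₀ below).

y₀ : (ℕ → ℕ) → ℕ → ℕ
y₀ y zero = 0
y₀ y (suc k) = y (suc k)

-- Validity of a tuple (x_j, ..., x_n) given previous entry bound:
-- Validity of (x_1,...,x_n):  x_1 ≤ y_n  and  x_{j+1} ≤ min(x_j, y_{n-j}).
-- Tail condition: for the remaining tuple (x_{j+1}, ..., x_n) (length m = n-j),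
-- its first entry satisfies x_{j+1} ≤ x_j and x_{j+1} ≤ y_{n-j} = y_m.
ValidTail : (ℕ → ℕ) → (m : ℕ) → ℕ → Vec ℕ m → Set
ValidTail y zero prev [] = ⊤
ValidTail y (suc m) prev (x ∷ xs) = (x ≤ prev × x ≤ y (suc m)) × ValidTail y m x xs

Valid : (ℕ → ℕ) → (n : ℕ) → Vec ℕ n → Set
Valid y zero [] = ⊤
Valid y (suc m) (x ∷ xs) = x ≤ y (suc m) × ValidTail y m x xs

validTail? : (y : ℕ → ℕ) (m : ℕ) (prev : ℕ) (xs : Vec ℕ m) → Dec (ValidTail y m prev xs)
validTail? y zero prev [] = yes _
validTail? y (suc m) prev (x ∷ xs) = ((x ≤? prev) ×-dec (x ≤? y (suc m))) ×-dec validTail? y m x xs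

valid? : (y : ℕ → ℕ) (n : ℕ) (xs : Vec ℕ n) → Dec (Valid y n xs)
valid? y zero [] = yes _
valid? y (suc m) (x ∷ xs) = (x ≤? y (suc m)) ×-dec validTail? y m x xs

boxVecs : (n b : ℕ) → List (Vec ℕ n)
boxVecs zero b = [] ∷ []
boxVecs (suc n) b = concatMap (λ x → map (x ∷_) (boxVecs n b)) (upTo (suc b))

-- W(n): the number of valid n-tuples.  Every valid n-tuple has all entries
-- ≤ x_1 ≤ y_n, so it suffices to enumerate the box {0..y_n}^n.
W : (ℕ → ℕ) → ℕ → ℕ
W y n = length (filter (valid? y n) (boxVecs n (y n)))

prodFrom : (ℕ → ℕ) → ℕ → ℕ → ℕ
prodFrom f a zero = 1
prodFrom f a (suc len) = f a * prodFrom f (suc a) len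

{-# OPTIONS --safe #-}
-- Let Tₘ(p) count the valid tails of length m following an entry p.  Splitting
-- on the first entry x of the tail, Tₘ₊₁(p) = Σ Tₘ(x) over x ≤ min(p, yₘ₊₁), and
-- W(m+1) is the same sum over x ≤ yₘ₊₁.  There are at most 1 + yₘ₊₁ summands, which
-- gives the upper bound by induction.  For the lower bound keep only the summands
-- with yₘ ≤ x ≤ yₘ₊₁: when p ≥ yₘ₊₁ there are 1 + yₘ₊₁ − yₘ of them, and each
-- x ≥ yₘ again satisfies the induction hypothesis Tₘ(x) ≥ ∏_{k<m} (1 + yₖ₊₁ − yₖ).
module Submission where

open import Defs
open import Data.Nat using (ℕ; zero; suc; _+_; _*_; _∸_; _≤_; _<_; _≤?_; z≤n; s≤s)
open import Data.Nat.Properties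
open import Data.Nat.ListAction using (sum)
open import Data.Nat.ListAction.Properties using (sum-++)
open import Data.List using (List; []; _∷_; [_]; _++_; map; concatMap; filter; length; upTo)
open import Data.List.Properties using (length-++; filter-++; map-++; map-cong; upTo-∷ʳ; filter-≐)
open import Data.Vec using (Vec; _∷_)
open import Data.Empty using (⊥-elim)
open import Data.Product using (_×_; _,_; proj₂)
open import Function using (_∘_)
open import Level using (0ℓ)
open import Relation.Nullary using (Dec; yes; no; ¬_)
open import Relation.Nullary.Decidable using (_×-dec_)
open import Relation.Unary using (Pred; Decidable)
open import Relation.Binary.PropositionalEquality using (_≡_; refl; sym; trans; cong; module ≡-Reasoning)

count : {A : Set} {P : Pred A 0ℓ} → Decidable P → List A → ℕ
count P? = length ∘ filter P?

sumBelow : (ℕ → ℕ) → ℕ → ℕ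
sumBelow f n = sum (map f (upTo n))

module _ {A : Set} {P : Pred A 0ℓ} (P? : Decidable P) where

  count-++ : ∀ xs ys → count P? (xs ++ ys) ≡ count P? xs + count P? ys
  count-++ xs ys = begin
    length (filter P? (xs ++ ys))               ≡⟨ cong length (filter-++ P? xs ys) ⟩
    length (filter P? xs ++ filter P? ys)       ≡⟨ length-++ (filter P? xs) ⟩
    count P? xs + count P? ys                   ∎
    where open ≡-Reasoning

  count-concatMap : {B : Set} (f : B → List A) (xs : List B) →
                    count P? (concatMap f xs) ≡ sum (map (count P? ∘ f) xs)
  count-concatMap f []       = refl
  count-concatMap f (x ∷ xs) rewrite count-++ (f x) (concatMap f xs) =
    cong (count P? (f x) +_) (count-concatMap f xs)

  count-map : {B : Set} (f : B → A) (xs : List B) → count P? (map f xs) ≡ count (P? ∘ f) xs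
  count-map f []       = refl
  count-map f (x ∷ xs) with P? (f x)
  ... | yes _ = cong suc (count-map f xs)
  ... | no  _ = count-map f xs

module _ {A : Set} {G : Set} {Q : Pred A 0ℓ} (Q? : Decidable Q) where

  count-×-dec-yes : (G? : Dec G) → G → ∀ xs → count (λ x → G? ×-dec Q? x) xs ≡ count Q? xs
  count-×-dec-yes G? g xs = cong length (filter-≐ (λ x → G? ×-dec Q? x) Q? (proj₂ , (g ,_)) xs)

  count-×-dec-no : (G? : Dec G) → ¬ G → ∀ xs → count (λ x → G? ×-dec Q? x) xs ≡ 0
  count-×-dec-no (yes g)   ¬g _        = ⊥-elim (¬g g)
  count-×-dec-no (no _)    ¬g []       = refl
  count-×-dec-no G?@(no _) ¬g (x ∷ xs) = count-×-dec-no G? ¬g xs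

  count-×-dec-≤ : (G? : Dec G) → ∀ xs → count (λ x → G? ×-dec Q? x) xs ≤ count Q? xs
  count-×-dec-≤ G?@(yes g) xs = ≤-reflexive (count-×-dec-yes G? g xs)
  count-×-dec-≤ G?@(no ¬g) xs rewrite count-×-dec-no G? ¬g xs = z≤n

count-boxVecs-suc : ∀ {m} {P : Pred (Vec ℕ (suc m)) 0ℓ} (P? : Decidable P) b →
                    count P? (boxVecs (suc m) b) ≡ sumBelow (λ x → count (P? ∘ (x ∷_)) (boxVecs m b)) (suc b)
count-boxVecs-suc {m} P? b = begin
  count P? (boxVecs (suc m) b)
    ≡⟨ count-concatMap P? (λ x → map (x ∷_) (boxVecs m b)) (upTo (suc b)) ⟩
  sum (map (λ x → count P? (map (x ∷_) (boxVecs m b))) (upTo (suc b)))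
    ≡⟨ cong sum (map-cong (λ x → count-map P? (x ∷_) (boxVecs m b)) (upTo (suc b))) ⟩
  sumBelow (λ x → count (P? ∘ (x ∷_)) (boxVecs m b)) (suc b) ∎
  where open ≡-Reasoning

module _ (f : ℕ → ℕ) where

  sumBelow-suc : ∀ n → sumBelow f (suc n) ≡ sumBelow f n + f n
  sumBelow-suc n = begin
    sum (map f (upTo (suc n)))          ≡⟨ cong (sum ∘ map f) (sym (upTo-∷ʳ n)) ⟩
    sum (map f (upTo n ++ [ n ]))       ≡⟨ cong sum (map-++ f (upTo n) [ n ]) ⟩
    sum (map f (upTo n) ++ [ f n ])     ≡⟨ sum-++ (map f (upTo n)) [ f n ] ⟩
    sumBelow f n + (f n + 0)            ≡⟨ cong (sumBelow f n +_) (+-identityʳ (f n)) ⟩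
    sumBelow f n + f n                  ∎
    where open ≡-Reasoning

  sumBelow-mono : ∀ {m n} → m ≤ n → sumBelow f m ≤ sumBelow f n
  sumBelow-mono {n = zero}  z≤n = ≤-refl
  sumBelow-mono {m} {suc n} m≤1+n with m ≤? n
  ... | yes m≤n = ≤-trans (sumBelow-mono m≤n)
                          (≤-trans (m≤m+n (sumBelow f n) (f n)) (≤-reflexive (sym (sumBelow-suc n))))
  ... | no  m≰n = ≤-reflexive (cong (sumBelow f) (≤-antisym m≤1+n (≰⇒> m≰n)))

  sumBelow-≤-* : ∀ {U} n → (∀ x → f x ≤ U) → sumBelow f n ≤ n * U
  sumBelow-≤-* zero    f≤U = z≤n
  sumBelow-≤-* {U} (suc n) f≤U rewrite sumBelow-suc n =
    ≤-trans (+-mono-≤ (sumBelow-≤-* n f≤U) (f≤U n)) (≤-reflexive (+-comm (n * U) U))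

  sumBelow-vanishing : ∀ {k} n → (∀ x → k ≤ x → f x ≡ 0) → sumBelow f n ≤ sumBelow f k
  sumBelow-vanishing zero      f≡0 = z≤n
  sumBelow-vanishing {k} (suc n) f≡0 with k ≤? n
  ... | yes k≤n rewrite sumBelow-suc n | f≡0 n k≤n | +-identityʳ (sumBelow f n) =
    sumBelow-vanishing n f≡0
  ... | no  k≰n = sumBelow-mono (≰⇒> k≰n)

  sumBelow-≥-* : ∀ {L a} n → (∀ x → a ≤ x → x < n → L ≤ f x) → (n ∸ a) * L ≤ sumBelow f n
  sumBelow-≥-* {L} {a} zero    L≤f rewrite 0∸n≡0 a = z≤n
  sumBelow-≥-* {L} {a} (suc n) L≤f with a ≤? n
  ... | no  a≰n rewrite m≤n⇒m∸n≡0 (≰⇒> a≰n) = z≤n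
  ... | yes a≤n rewrite +-∸-assoc 1 a≤n | sumBelow-suc n =
    ≤-trans (≤-reflexive (+-comm L ((n ∸ a) * L)))
            (+-mono-≤ (sumBelow-≥-* n (λ x a≤x x<n → L≤f x a≤x (m≤n⇒m≤1+n x<n))) (L≤f n a≤n ≤-refl))

prodFrom-snoc : ∀ f a m → prodFrom f a (suc m) ≡ prodFrom f a m * f (a + m)
prodFrom-snoc f a zero    rewrite +-identityʳ a = *-comm (f a) 1
prodFrom-snoc f a (suc m) = begin
  f a * prodFrom f (suc a) (suc m)            ≡⟨ cong (f a *_) (prodFrom-snoc f (suc a) m) ⟩
  f a * (prodFrom f (suc a) m * f (suc a + m)) ≡⟨ sym (*-assoc (f a) _ _) ⟩
  prodFrom f a (suc m) * f (suc a + m)        ≡⟨ cong (λ k → prodFrom f a (suc m) * f k) (sym (+-suc a m)) ⟩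
  prodFrom f a (suc m) * f (a + suc m)        ∎
  where open ≡-Reasoning

module _ (y : ℕ → ℕ) where

  tailCount : (m p b : ℕ) → ℕ
  tailCount m p b = count (validTail? y m p) (boxVecs m b)

  upperProd : ℕ → ℕ
  upperProd = prodFrom (λ k → 1 + y k) 1

  lowerProd : ℕ → ℕ
  lowerProd = prodFrom (λ k → 1 + (y₀ y (suc k) ∸ y₀ y k)) 0

  upperProd-suc : ∀ m → upperProd (suc m) ≡ suc (y (suc m)) * upperProd m
  upperProd-suc m = trans (prodFrom-snoc _ 1 m) (*-comm (upperProd m) _)

  lowerProd-suc : ∀ m → lowerProd (suc m) ≡ suc (y (suc m) ∸ y₀ y m) * lowerProd m
  lowerProd-suc m = trans (prodFrom-snoc _ 0 m) (*-comm (lowerProd m) _)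

  headCount : (m b : ℕ) {G : Pred ℕ 0ℓ} → Decidable G → ℕ → ℕ
  headCount m b G? x = count (λ xs → G? x ×-dec validTail? y m x xs) (boxVecs m b)

  headSum : (m b : ℕ) {G : Pred ℕ 0ℓ} → Decidable G → ℕ
  headSum m b G? = sumBelow (headCount m b G?) (suc b)

  tailGuard : (m p : ℕ) → Decidable (λ x → x ≤ p × x ≤ y (suc m))
  tailGuard m p x = x ≤? p ×-dec x ≤? y (suc m)

  tailCount-suc : ∀ m p b → tailCount (suc m) p b ≡ headSum m b (tailGuard m p)
  tailCount-suc m p b = count-boxVecs-suc (validTail? y (suc m) p) b

  W-suc : ∀ m → W y (suc m) ≡ headSum m (y (suc m)) (_≤? y (suc m))
  W-suc m = count-boxVecs-suc (valid? y (suc m)) (y (suc m))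

  headSum-≤ : ∀ m b {G : Pred ℕ 0ℓ} (G? : Decidable G) {U} →
              (∀ x → G x → x ≤ y (suc m)) → (∀ x → tailCount m x b ≤ U) →
              headSum m b G? ≤ suc (y (suc m)) * U
  headSum-≤ m b G? {U} G⇒≤y tail≤U =
    ≤-trans (sumBelow-vanishing _ (suc b) vanish) (sumBelow-≤-* _ (suc (y (suc m))) bound)
    where
    vanish : ∀ x → suc (y (suc m)) ≤ x → headCount m b G? x ≡ 0
    vanish x y<x = count-×-dec-no (validTail? y m x) (G? x) (λ g → <⇒≱ y<x (G⇒≤y x g)) (boxVecs m b)

    bound : ∀ x → headCount m b G? x ≤ U
    bound x = ≤-trans (count-×-dec-≤ (validTail? y m x) (G? x) (boxVecs m b)) (tail≤U x)

  headSum-≥ : ∀ m b {G : Pred ℕ 0ℓ} (G? : Decidable G) {L} →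
              y₀ y m ≤ y (suc m) → y (suc m) ≤ b →
              (∀ x → y₀ y m ≤ x → x ≤ y (suc m) → G x × L ≤ tailCount m x b) →
              suc (y (suc m) ∸ y₀ y m) * L ≤ headSum m b G?
  headSum-≥ m b G? {L} y₀≤y y≤b good = begin
    suc (y (suc m) ∸ y₀ y m) * L                  ≡⟨ cong (_* L) (sym (+-∸-assoc 1 y₀≤y)) ⟩
    (suc (y (suc m)) ∸ y₀ y m) * L                ≤⟨ sumBelow-≥-* _ (suc (y (suc m))) bound ⟩
    sumBelow (headCount m b G?) (suc (y (suc m))) ≤⟨ sumBelow-mono _ (s≤s y≤b) ⟩
    headSum m b G?                                ∎
    where
    open ≤-Reasoning
    bound : ∀ x → y₀ y m ≤ x → x < suc (y (suc m)) → L ≤ headCount m b G? x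
    bound x y₀≤x (s≤s x≤y) with good x y₀≤x x≤y
    ... | g , L≤tail rewrite count-×-dec-yes (validTail? y m x) (G? x) g (boxVecs m b) = L≤tail

  y₀-≤-next : (∀ m n → 1 ≤ m → m ≤ n → y m ≤ y n) → ∀ m → y₀ y m ≤ y (suc m)
  y₀-≤-next mono zero    = z≤n
  y₀-≤-next mono (suc m) = mono (suc m) (suc (suc m)) (s≤s z≤n) (n≤1+n (suc m))

  tailCount-≤ : ∀ m p b → tailCount m p b ≤ upperProd m
  tailCount-≤ zero    p b = ≤-refl
  tailCount-≤ (suc m) p b = begin
    tailCount (suc m) p b          ≡⟨ tailCount-suc m p b ⟩
    headSum m b (tailGuard m p)    ≤⟨ headSum-≤ m b (tailGuard m p) (λ x → proj₂) (λ x → tailCount-≤ m x b) ⟩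
    suc (y (suc m)) * upperProd m  ≡⟨ sym (upperProd-suc m) ⟩
    upperProd (suc m)              ∎
    where open ≤-Reasoning

  W-≤ : ∀ m → W y (suc m) ≤ upperProd (suc m)
  W-≤ m = begin
    W y (suc m)                                  ≡⟨ W-suc m ⟩
    headSum m (y (suc m)) (_≤? y (suc m))        ≤⟨ headSum-≤ m _ (_≤? y (suc m)) (λ x x≤y → x≤y) (λ x → tailCount-≤ m x _) ⟩
    suc (y (suc m)) * upperProd m                ≡⟨ sym (upperProd-suc m) ⟩
    upperProd (suc m)                            ∎
    where open ≤-Reasoning

  module _ (y₀≤y : ∀ m → y₀ y m ≤ y (suc m)) where

    tailCount-≥ : ∀ m p b → y₀ y m ≤ p → p ≤ b → lowerProd m ≤ tailCount m p b
    tailCount-≥ zero    p b _   _   = ≤-refl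
    tailCount-≥ (suc m) p b y≤p p≤b = begin
      lowerProd (suc m)                       ≡⟨ lowerProd-suc m ⟩
      suc (y (suc m) ∸ y₀ y m) * lowerProd m  ≤⟨ headSum-≥ m b (tailGuard m p) (y₀≤y m) (≤-trans y≤p p≤b) good ⟩
      headSum m b (tailGuard m p)             ≡⟨ sym (tailCount-suc m p b) ⟩
      tailCount (suc m) p b                   ∎
      where
      open ≤-Reasoning
      good : ∀ x → y₀ y m ≤ x → x ≤ y (suc m) → (x ≤ p × x ≤ y (suc m)) × lowerProd m ≤ tailCount m x b
      good x y₀≤x x≤y = (≤-trans x≤y y≤p , x≤y) , tailCount-≥ m x b y₀≤x (≤-trans x≤y (≤-trans y≤p p≤b))

    W-≥ : ∀ m → lowerProd (suc m) ≤ W y (suc m)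
    W-≥ m = begin
      lowerProd (suc m)                            ≡⟨ lowerProd-suc m ⟩
      suc (y (suc m) ∸ y₀ y m) * lowerProd m       ≤⟨ headSum-≥ m _ (_≤? y (suc m)) (y₀≤y m) ≤-refl good ⟩
      headSum m (y (suc m)) (_≤? y (suc m))        ≡⟨ sym (W-suc m) ⟩
      W y (suc m)                                  ∎
      where
      open ≤-Reasoning
      good : ∀ x → y₀ y m ≤ x → x ≤ y (suc m) → x ≤ y (suc m) × lowerProd m ≤ tailCount m x (y (suc m))
      good x y₀≤x x≤y = x≤y , tailCount-≥ m x _ y₀≤x x≤y

theorem6p3 : (y : ℕ → ℕ) →
    (∀ n → 1 ≤ n → 1 ≤ y n) →
    (∀ m n → 1 ≤ m → m ≤ n → y m ≤ y n) →
    ∀ n → 1 ≤ n →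
      (prodFrom (λ k → 1 + (y₀ y (suc k) ∸ y₀ y k)) 0 n ≤ W y n)
      × (W y n ≤ prodFrom (λ k → 1 + y k) 1 n)
theorem6p3 y _ mono (suc m) _ = W-≥ y (y₀-≤-next y mono) m , W-≤ y m
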